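{- For all session types with priorities $S,S'$: (i) $\mathbf{Synth}(S\dashv S')\neq\mathbf{fail}$ if and only if $S\dashv S'$; (ii) if $\mathsf f=\mathbf{Synth}(S\dashv S')\neq\mathbf{fail}$, then $\mathsf f : S\dashv S'$ and $\mathsf f$ is deterministic.
   Context: Ground types $G$ are, e.g., $\mathtt{Nat},\mathtt{Bool}$; labels range over $\mathcal L$; polarities are $p\in\{+,-\}$. Session types with priorities are $$S ::= \mathsf{end}\mid ?G.S\mid !G.S\mid ?(S_1^p).S_2\mid !(S_1^p).S_2\mid\oplus\{l_i{:}S_i\}_{i\in I}\mid\&\{l_i{:}S_i\}_{i\in I}\mid\langle\!\langle l_1{:}S_1,\ldots,l_n{:}S_n\rangle\!\rangle\ (n\ge1).$$ The last constructor, speculative selection, is an ordered list with pairwise distinct labels, where $l_i$ has higher priority than $l_{i+1}$. Orchestrators are $\mathsf f ::= \mathfrak 1\mid\bullet.\mathsf f\mid l.\mathsf f\mid l.\mathsf f+l'.\mathsf g\mid l.\mathsf f\oplus l'.\mathsf g$ ($l\ne l'$), with $n$-ary forms $\sum_i l_i.\mathsf f_i$ and $\bigoplus_i l_i.\mathsf f_i$ (a singleton is a prefix). An orchestrator is deterministic if it contains no occurrence of $\oplus$. Orchestrated compliance $\mathsf f:S\dashv S'$ is the least relation with: (1) $\mathfrak 1:\mathsf{end}\dashv S$; (2) $\mathsf f:S\dashv S'\Rightarrow\bullet.\mathsf f:?G.S\dashv !G.S'$ and $\bullet.\mathsf f:!G.S\dashv ?G.S'$; (2') $\mathsf f:S_2\dashv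 S'_2\Rightarrow\bullet.\mathsf f:?(S_1^p).S_2\dashv !(S_1^p).S'_2$ and $\bullet.\mathsf f:!(S_1^p).S_2\dashv ?(S_1^p).S'_2$; (3) if $\mathsf f_i:S_i\dashv S'_i$ for all $i\in I$, then for any $J$: $\sum_{i\in I}l_i.\mathsf f_i:\oplus\{l_i{:}S_i\}_{i\in I}\dashv\&\{l_j{:}S'_j\}_{j\in I\cup J}$ and $\sum_{i\in I}l_i.\mathsf f_i:\&\{l_j{:}S_j\}_{j\in I\cup J}\dashv\oplus\{l_i{:}S'_i\}_{i\in I}$; (4) if $\emptyset\ne H\subseteq I\cap J$ and $\mathsf f_h:S_h\dashv S'_h$ for all $h\in H$, then $\bigoplus_{h\in H}l_h.\mathsf f_h:\langle\!\langle l_i{:}S_i\rangle\!\rangle_{i\in I}\dashv\&\{l_j{:}S'_j\}_{j\in J}$ and $\bigoplus_{h\in H}l_h.\mathsf f_h:\&\{l_j{:}S_j\}_{j\in J}\dashv\langle\!\langle l_i{:}S'_i\rangle\!\rangle_{i\in I}$. Here $I$ is the index set of the speculative list, whose order is ignored. $S\dashv S'$ means $\mathsf f:S\dashv S'$ for some $\mathsf f$. The algorithm $\mathbf{Synth}(S\dashv S')$ is defined by cases: - if $S=\mathsf{end}$: return $\mathfrak 1$; - else if $(S,S')=(?G.S_1,\,!G.S_1')$ or $(!G.S_1,\,?G.S_1')$: let $\mathsf f=\mathbf{Synth}(S_1\dashv S_1')$ and return $\bullet.\mathsf f$ if $\mathsf f\ne\mathbf{fail}$, else $\mathbf{fail}$;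 - else if $(S,S')=(?(S_1^p).S_2,\,!(S_1^p).S_2')$ or $(!(S_1^p).S_2,\,?(S_1^p).S_2')$: let $\mathsf f=\mathbf{Synth}(S_2\dashv S_2')$ and return $\bullet.\mathsf f$ if $\mathsf f\ne\mathbf{fail}$, else $\mathbf{fail}$; - else if $(S,S')=(\&\{l_i{:}S_i\}_{i\in I},\,\langle\!\langle l_j{:}S'_j\rangle\!\rangle_{j\in J})$ or $(\langle\!\langle l_j{:}S_j\rangle\!\rangle_{j\in J},\,\&\{l_i{:}S'_i\}_{i\in I})$: let $res=\mathbf{Synth}^{\mathbf{fst}}([S_h\dashv S'_h]_{h\in I\cap J})$, where the list is ordered by the priority order of the speculative selection; return $\mathbf{fail}$ if $res=\mathbf{fail}$, otherwise return $l_c.\mathsf f$ where $(\mathsf f,c)=res$; - else if $(S,S')=(\oplus\{l_i{:}S_i\}_{i\in I},\,\&\{l_j{:}S'_j\}_{j\in J})$ or $(\&\{l_j{:}S_j\}_{j\in J},\,\oplus\{l_i{:}S'_i\}_{i\in I})$: let $\mathsf f_i=\mathbf{Synth}(S_i\dashv S'_i)$ for $i\in I$; return $\sum_{i\in I}l_i.\mathsf f_i$ if all $\mathsf f_i\ne\mathbf{fail}$, else $\mathbf{fail}$; - else return $\mathbf{fail}$. $\mathbf{Synth}^{\mathbf{fst}}([\,])=\mathbf{fail}$, and $\mathbf{Synth}^{\mathbf{fst}}((S_c\dashv S'_c):xs)$: let $\mathsf f=\mathbf{Synth}(S_c\dashv S'_c)$; if $\mathsf f\ne\mathbf{fail}$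 return $(\mathsf f,c)$, else return $\mathbf{Synth}^{\mathbf{fst}}(xs)$. -}

module Defs where

open import Data.Bool using (Bool; true; false; _∧_; if_then_else_)
open import Data.List using (List; []; _∷_; map)
open import Data.List.Relation.Unary.All using (All)
open import Data.List.Relation.Unary.Unique.Propositional using (Unique)
open import Data.List.Membership.Propositional using (_∈_)
open import Data.Maybe using (Maybe; just; nothing)
open import Data.Product using (_×_; _,_; proj₁; proj₂; ∃; ∃₂)
open import Relation.Binary.Definitions using (DecidableEquality)
open import Relation.Nullary.Decidable using (⌊_⌋)
open import Relation.Binary.PropositionalEquality using (_≡_)

data Pol : Set where
  pos neg : Pol

eqPol : Pol → Pol → Bool
eqPol pos pos = true
eqPol neg neg = true
eqPol _   _   = false

-- Branchings are lists of (label , continuation); the speculative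
-- selection list is ordered by priority (head = highest priority).

data SType (G L : Set) : Set where
  end   : SType G L
  recv  : G → SType G L → SType G L
  send  : G → SType G L → SType G L
  drecv : SType G L → Pol → SType G L → SType G L
  dsend : SType G L → Pol → SType G L → SType G L
  sel   : List (L × SType G L) → SType G L
  bra   : List (L × SType G L) → SType G L
  spec  : List (L × SType G L) → SType G L

labels : ∀ {A L : Set} → List (L × A) → List L
labels = map proj₁

data WF {G L : Set} : SType G L → Set where
  wf-end   : WF end
  wf-recv  : ∀ {g S} → WF S → WF (recv g S)
  wf-send  : ∀ {g S} → WF S → WF (send g S)
  wf-drecv : ∀ {S₁ p S₂} → WF S₁ → WF S₂ → WF (drecv S₁ p S₂)
  wf-dsend : ∀ {S₁ p S₂} → WF S₁ → WF S₂ → WF (dsend S₁ p S₂)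
  wf-sel   : ∀ {xs} → Unique (labels xs) → All (λ b → WF (proj₂ b)) xs → WF (sel xs)
  wf-bra   : ∀ {xs} → Unique (labels xs) → All (λ b → WF (proj₂ b)) xs → WF (bra xs)
  wf-spec  : ∀ {b xs} → Unique (labels (b ∷ xs)) → All (λ b → WF (proj₂ b)) (b ∷ xs)
           → WF (spec (b ∷ xs))

data Orch (L : Set) : Set where
  𝟙   : Orch L
  •_  : Orch L → Orch L
  -- n-ary sum  Σ_i l_i.f_i ; a singleton sum [ (l , f) ] is the prefix l.f
  Σₒ  : List (L × Orch L) → Orch L
  ⊕ₒ  : L × Orch L → L × Orch L → List (L × Orch L) → Orch L

-- ⨁ over a nonempty list; a singleton ⨁ is the prefix l.f
⨁ : ∀ {L} → L × Orch L → List (L × Orch L) → Orch L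
⨁ h []         = Σₒ (h ∷ [])
⨁ h (h' ∷ hs)  = ⊕ₒ h h' hs

data Deterministic {L : Set} : Orch L → Set where
  det-𝟙 : Deterministic 𝟙
  det-• : ∀ {f} → Deterministic f → Deterministic (• f)
  det-Σ : ∀ {fs} → All (λ b → Deterministic (proj₂ b)) fs → Deterministic (Σₒ fs)

infix 4 _∶_⊣_ _⊣_

data _∶_⊣_ {G L : Set} : Orch L → SType G L → SType G L → Set where
  c-end   : ∀ {S'} → 𝟙 ∶ end ⊣ S'
  c-recv  : ∀ {f g S S'} → f ∶ S ⊣ S' → • f ∶ recv g S ⊣ send g S'
  c-send  : ∀ {f g S S'} → f ∶ S ⊣ S' → • f ∶ send g S ⊣ recv g S'
  c-drecv : ∀ {f S₁ p S₂ S₂'} → f ∶ S₂ ⊣ S₂' → • f ∶ drecv S₁ p S₂ ⊣ dsend S₁ p S₂'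
  c-dsend : ∀ {f S₁ p S₂ S₂'} → f ∶ S₂ ⊣ S₂' → • f ∶ dsend S₁ p S₂ ⊣ drecv S₁ p S₂'
  -- (3), first form: Σ_{i∈I} l_i.f_i : ⊕{l_i:S_i}_{i∈I} ⊣ &{l_j:S'_j}_{j∈I∪J}
  --   fs lists, in the order of the ⊕-branching, (l_i , f_i) with
  --   f_i : S_i ⊣ S'_i where (l_i , S'_i) is a branch of the &.
  c-sel   : ∀ {xs ys} (fs : List (L × Orch L))
          → labels fs ≡ labels xs
          → All (λ lf → ∃₂ λ T T' → (proj₁ lf , T) ∈ xs × (proj₁ lf , T') ∈ ys × proj₂ lf ∶ T ⊣ T') fs
          → Σₒ fs ∶ sel xs ⊣ bra ys
  c-bra   : ∀ {ys xs} (fs : List (L × Orch L))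
          → labels fs ≡ labels xs
          → All (λ lf → ∃₂ λ T T' → (proj₁ lf , T) ∈ ys × (proj₁ lf , T') ∈ xs × proj₂ lf ∶ T ⊣ T') fs
          → Σₒ fs ∶ bra ys ⊣ sel xs
  -- (4), first form: ⨁_{h∈H} l_h.f_h : ⟨⟨l_i:S_i⟩⟩_{i∈I} ⊣ &{l_j:S'_j}_{j∈J},  ∅ ≠ H ⊆ I ∩ J
  c-spec  : ∀ {xs ys} (h : L × Orch L) (hs : List (L × Orch L))
          → Unique (labels (h ∷ hs))
          → All (λ lf → ∃₂ λ T T' → (proj₁ lf , T) ∈ xs × (proj₁ lf , T') ∈ ys × proj₂ lf ∶ T ⊣ T') (h ∷ hs)
          → ⨁ h hs ∶ spec xs ⊣ bra ys
  c-bspec : ∀ {ys xs} (h : L × Orch L) (hs : List (L × Orch L))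
          → Unique (labels (h ∷ hs))
          → All (λ lf → ∃₂ λ T T' → (proj₁ lf , T) ∈ ys × (proj₁ lf , T') ∈ xs × proj₂ lf ∶ T ⊣ T') (h ∷ hs)
          → ⨁ h hs ∶ bra ys ⊣ spec xs

_⊣_ : ∀ {G L : Set} → SType G L → SType G L → Set
_⊣_ {L = L} S S' = ∃ λ (f : Orch L) → f ∶ S ⊣ S'

-- The algorithm Synth; fail is represented by nothing.

module _ {G L : Set} (_≟G_ : DecidableEquality G) (_≟L_ : DecidableEquality L) where

  mutual
    eqS : SType G L → SType G L → Bool
    eqS end end = true
    eqS (recv g S) (recv g' S') = ⌊ g ≟G g' ⌋ ∧ eqS S S'
    eqS (send g S) (send g' S') = ⌊ g ≟G g' ⌋ ∧ eqS S S'
    eqS (drecv S₁ p S₂) (drecv S₁' p' S₂') = eqS S₁ S₁' ∧ (eqPol p p' ∧ eqS S₂ S₂')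
    eqS (dsend S₁ p S₂) (dsend S₁' p' S₂') = eqS S₁ S₁' ∧ (eqPol p p' ∧ eqS S₂ S₂')
    eqS (sel xs) (sel ys) = eqBr xs ys
    eqS (bra xs) (bra ys) = eqBr xs ys
    eqS (spec xs) (spec ys) = eqBr xs ys
    eqS _ _ = false

    eqBr : List (L × SType G L) → List (L × SType G L) → Bool
    eqBr [] [] = true
    eqBr ((l , S) ∷ xs) ((l' , S') ∷ ys) = ⌊ l ≟L l' ⌋ ∧ (eqS S S' ∧ eqBr xs ys)
    eqBr _ _ = false

  mutual
    Synth : SType G L → SType G L → Maybe (Orch L)
    Synth end _ = just 𝟙
    Synth (recv g S) (send g' S') = if ⌊ g ≟G g' ⌋ then •? (Synth S S') else nothing
    Synth (send g S) (recv g' S') = if ⌊ g ≟G g' ⌋ then •? (Synth S S') else nothing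
    Synth (drecv S₁ p S₂) (dsend S₁' p' S₂') =
      if eqS S₁ S₁' ∧ eqPol p p' then •? (Synth S₂ S₂') else nothing
    Synth (dsend S₁ p S₂) (drecv S₁' p' S₂') =
      if eqS S₁ S₁' ∧ eqPol p p' then •? (Synth S₂ S₂') else nothing
    -- (&{l_i:S_i}_I , ⟨⟨l_j:S'_j⟩⟩_J): first success in priority order
    Synth (bra xs) (spec ys) = fstR ys xs
    Synth (spec ys) (bra xs) = fstL ys xs
    Synth (sel xs) (bra ys) = Σ? (sumL xs ys)
    Synth (bra ys) (sel xs) = Σ? (sumR xs ys)
    Synth _ _ = nothing

    findL : L → SType G L → List (L × SType G L) → Maybe (Orch L)
    findL l T [] = nothing
    findL l T ((l' , T') ∷ ys) = if ⌊ l ≟L l' ⌋ then Synth T T' else findL l T ys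

    findR : L → SType G L → List (L × SType G L) → Maybe (Orch L)
    findR l T' [] = nothing
    findR l T' ((l' , T) ∷ ys) = if ⌊ l ≟L l' ⌋ then Synth T T' else findR l T' ys

    fstL : List (L × SType G L) → List (L × SType G L) → Maybe (Orch L)
    fstL [] xs = nothing
    fstL ((l , T) ∷ ys) xs = orElse (prefix l (findL l T xs)) (fstL ys xs)

    fstR : List (L × SType G L) → List (L × SType G L) → Maybe (Orch L)
    fstR [] xs = nothing
    fstR ((l , T') ∷ ys) xs = orElse (prefix l (findR l T' xs)) (fstR ys xs)

    sumL : List (L × SType G L) → List (L × SType G L) → Maybe (List (L × Orch L))
    sumL [] ys = just []
    sumL ((l , T) ∷ xs) ys = cons? l (findL l T ys) (sumL xs ys)

    sumR : List (L × SType G L) → List (L × SType G L) → Maybe (List (L × Orch L))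
    sumR [] ys = just []
    sumR ((l , T') ∷ xs) ys = cons? l (findR l T' ys) (sumR xs ys)

    •? : Maybe (Orch L) → Maybe (Orch L)
    •? (just f) = just (• f)
    •? nothing  = nothing

    Σ? : Maybe (List (L × Orch L)) → Maybe (Orch L)
    Σ? (just fs) = just (Σₒ fs)
    Σ? nothing   = nothing

    prefix : L → Maybe (Orch L) → Maybe (Orch L)
    prefix l (just f) = just (Σₒ ((l , f) ∷ []))
    prefix l nothing  = nothing

    orElse : Maybe (Orch L) → Maybe (Orch L) → Maybe (Orch L)
    orElse (just f) _ = just f
    orElse nothing  m = m

    cons? : L → Maybe (Orch L) → Maybe (List (L × Orch L)) → Maybe (List (L × Orch L))
    cons? l (just f) (just fs) = just ((l , f) ∷ fs)
    cons? l _ _ = nothing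

-- Soundness follows the recursion of Synth: every successful clause is an instance of the
-- compliance rule for that pair of shapes, and on a speculative selection Synth commits to
-- the first common branch that succeeds, i.e. returns a prefix l.f, so no ⊕ is ever produced.
-- Completeness is by induction on the compliance derivation: since labels are distinct, the
-- label lookups performed by Synth find exactly the branches used by the derivation, and for
-- a speculative selection one compliant common branch suffices because Synth^fst tries them all.
module Submission where

open import Data.Bool using (true; false; T; _∧_)
open import Data.Bool.Properties using (T-∧; T-≡)
open import Data.Empty using (⊥-elim)
open import Data.List using (List; []; _∷_)
open import Data.List.Membership.Propositional using (_∈_)
open import Data.List.Membership.Propositional.Properties using (∈-map⁺; ∈-map⁻)
open import Data.List.Relation.Binary.Subset.Propositional using (_⊆_)
open import Data.List.Relation.Binary.Subset.Propositional.Properties using (⊆-refl)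
open import Data.List.Relation.Unary.All as All using (All; []; _∷_)
open import Data.List.Relation.Unary.AllPairs using ([]; _∷_)
open import Data.List.Relation.Unary.Any using (here; there)
open import Data.List.Relation.Unary.Unique.Propositional using (Unique)
open import Data.Maybe using (Maybe; just; nothing; Is-just)
open import Data.Maybe.Relation.Unary.All as Maybe using (just; nothing)
open import Data.Maybe.Relation.Unary.Any using (just)
open import Data.Product using (_×_; _,_; proj₁; proj₂; ∃; ∃₂)
open import Data.Unit using (tt)
open import Function using (_∘_)
open import Function.Bundles using (_⇔_; mk⇔; module Equivalence)
open import Relation.Binary.Definitions using (DecidableEquality)
open import Relation.Binary.PropositionalEquality using (_≡_; _≢_; refl; sym; cong; cong₂; subst; ≡-≟-identity)
open import Relation.Nullary.Decidable using (yes; no; ⌊_⌋; toWitness; fromWitness)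

open import Defs

open Equivalence using (to; from)

All⇒∃ : ∀ {A : Set} {P : A → Set} {m : Maybe A} → Maybe.All P m → m ≢ nothing → ∃ P
All⇒∃ (just p) _  = _ , p
All⇒∃ nothing  ≢n = ⊥-elim (≢n refl)

All-≡just : ∀ {A : Set} {P : A → Set} {m : Maybe A} {x} → Maybe.All P m → m ≡ just x → P x
All-≡just (just p) refl = p

Is-just⇒≢nothing : ∀ {A : Set} {m : Maybe A} → Is-just m → m ≢ nothing
Is-just⇒≢nothing (just _) ()

unique-labels⇒≡ : ∀ {A L : Set} {xs : List (L × A)} {l a b} →
                  Unique (labels xs) → (l , a) ∈ xs → (l , b) ∈ xs → a ≡ b
unique-labels⇒≡ _         (here refl) (here refl) = refl
unique-labels⇒≡ (l∉ ∷ _) (here refl) (there m)   = ⊥-elim (All.lookup l∉ (∈-map⁺ proj₁ m) refl)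
unique-labels⇒≡ (l∉ ∷ _) (there m)   (here refl) = ⊥-elim (All.lookup l∉ (∈-map⁺ proj₁ m) refl)
unique-labels⇒≡ (_ ∷ u)  (there m)   (there m')  = unique-labels⇒≡ u m m'

All-at-label : ∀ {A B L : Set} {P : L × A → Set} {fs : List (L × A)} {xs : List (L × B)} {l b} →
               labels fs ≡ labels xs → (l , b) ∈ xs → All P fs → ∃ λ a → P (l , a)
All-at-label lab m ps with (_ , a) , m′ , refl ← ∈-map⁻ proj₁ (subst (_ ∈_) (sym lab) (∈-map⁺ proj₁ m)) =
  a , All.lookup ps m′

module _ {G L : Set} (_≟G_ : DecidableEquality G) (_≟L_ : DecidableEquality L) where

  Branches : Set
  Branches = List (L × SType G L)

  WF-branches : Branches → Set
  WF-branches = All (λ b → WF (proj₂ b))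

  Correct : SType G L → SType G L → Orch L → Set
  Correct S S' f = (f ∶ S ⊣ S') × Deterministic f

  -- Matched _∶_⊣_ is the branch premise of the compliance rules (3) and (4).
  Matched : (Orch L → SType G L → SType G L → Set) → Branches → Branches → L × Orch L → Set
  Matched R xs ys lf = ∃₂ λ U U' → (proj₁ lf , U) ∈ xs × (proj₁ lf , U') ∈ ys × R (proj₂ lf) U U'

  CorrectBranch : Branches → Branches → L × Orch L → Set
  CorrectBranch = Matched λ f U U' → Correct U U' f

  SolvableBranch : Branches → Branches → L × Orch L → Set
  SolvableBranch = Matched λ _ U U' → Is-just (Synth _≟G_ _≟L_ U U')

  •?-All : ∀ {P : Orch L → Set} {m} → Maybe.All (P ∘ •_) m → Maybe.All P (•? _≟G_ _≟L_ m)
  •?-All (just p) = just p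
  •?-All nothing  = nothing

  Σ?-All : ∀ {P : Orch L → Set} {m} → Maybe.All (P ∘ Σₒ) m → Maybe.All P (Σ? _≟G_ _≟L_ m)
  Σ?-All (just p) = just p
  Σ?-All nothing  = nothing

  prefix-All : ∀ {P : Orch L → Set} {l m} →
               Maybe.All (λ f → P (Σₒ ((l , f) ∷ []))) m → Maybe.All P (prefix _≟G_ _≟L_ l m)
  prefix-All (just p) = just p
  prefix-All nothing  = nothing

  orElse-All : ∀ {P : Orch L → Set} {m m'} →
               Maybe.All P m → Maybe.All P m' → Maybe.All P (orElse _≟G_ _≟L_ m m')
  orElse-All (just p) _ = just p
  orElse-All nothing  q = q

  cons?-All : ∀ {P : Orch L → Set} {Q R : List (L × Orch L) → Set} {l m ms} →
              (∀ {f fs} → P f → Q fs → R ((l , f) ∷ fs)) →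
              Maybe.All P m → Maybe.All Q ms → Maybe.All R (cons? _≟G_ _≟L_ l m ms)
  cons?-All k (just p) (just q) = just (k p q)
  cons?-All k (just _) nothing  = nothing
  cons?-All k nothing  _        = nothing

  •?-Is-just : ∀ {m} → Is-just m → Is-just (•? _≟G_ _≟L_ m)
  •?-Is-just (just _) = just tt

  Σ?-Is-just : ∀ {m} → Is-just m → Is-just (Σ? _≟G_ _≟L_ m)
  Σ?-Is-just (just _) = just tt

  prefix-Is-just : ∀ {l m} → Is-just m → Is-just (prefix _≟G_ _≟L_ l m)
  prefix-Is-just (just _) = just tt

  orElse-Is-justˡ : ∀ {m m'} → Is-just m → Is-just (orElse _≟G_ _≟L_ m m')
  orElse-Is-justˡ (just _) = just tt

  orElse-Is-justʳ : ∀ {m m'} → Is-just m' → Is-just (orElse _≟G_ _≟L_ m m')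
  orElse-Is-justʳ {just _}  _ = just tt
  orElse-Is-justʳ {nothing} j = j

  cons?-Is-just : ∀ {l m ms} → Is-just m → Is-just ms → Is-just (cons? _≟G_ _≟L_ l m ms)
  cons?-Is-just (just _) (just _) = just tt

  eqPol-sound : ∀ p p' → T (eqPol p p') → p ≡ p'
  eqPol-sound pos pos _ = refl
  eqPol-sound neg neg _ = refl

  eqPol-refl : ∀ p → T (eqPol p p)
  eqPol-refl pos = tt
  eqPol-refl neg = tt

  mutual
    eqS-sound : ∀ S S' → T (eqS _≟G_ _≟L_ S S') → S ≡ S'
    eqS-sound end end _ = refl
    eqS-sound (recv g S) (recv g' S') e =
      let g≡ , S≡ = to T-∧ e in cong₂ recv (toWitness g≡) (eqS-sound S S' S≡)
    eqS-sound (send g S) (send g' S') e =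
      let g≡ , S≡ = to T-∧ e in cong₂ send (toWitness g≡) (eqS-sound S S' S≡)
    eqS-sound (drecv S₁ p S₂) (drecv S₁' p' S₂') e
      with S₁≡ , e₂₃ ← to T-∧ e
      with p≡ , S₂≡ ← to T-∧ e₂₃
      with refl ← eqS-sound S₁ S₁' S₁≡ | refl ← eqPol-sound p p' p≡ | refl ← eqS-sound S₂ S₂' S₂≡ = refl
    eqS-sound (dsend S₁ p S₂) (dsend S₁' p' S₂') e
      with S₁≡ , e₂₃ ← to T-∧ e
      with p≡ , S₂≡ ← to T-∧ e₂₃
      with refl ← eqS-sound S₁ S₁' S₁≡ | refl ← eqPol-sound p p' p≡ | refl ← eqS-sound S₂ S₂' S₂≡ = refl
    eqS-sound (sel xs)  (sel ys)  e = cong sel  (eqBr-sound xs ys e)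
    eqS-sound (bra xs)  (bra ys)  e = cong bra  (eqBr-sound xs ys e)
    eqS-sound (spec xs) (spec ys) e = cong spec (eqBr-sound xs ys e)
    eqS-sound end (recv _ _) ()
    eqS-sound end (send _ _) ()
    eqS-sound end (drecv _ _ _) ()
    eqS-sound end (dsend _ _ _) ()
    eqS-sound end (sel _) ()
    eqS-sound end (bra _) ()
    eqS-sound end (spec _) ()
    eqS-sound (recv _ _) end ()
    eqS-sound (recv _ _) (send _ _) ()
    eqS-sound (recv _ _) (drecv _ _ _) ()
    eqS-sound (recv _ _) (dsend _ _ _) ()
    eqS-sound (recv _ _) (sel _) ()
    eqS-sound (recv _ _) (bra _) ()
    eqS-sound (recv _ _) (spec _) ()
    eqS-sound (send _ _) end ()
    eqS-sound (send _ _) (recv _ _) ()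
    eqS-sound (send _ _) (drecv _ _ _) ()
    eqS-sound (send _ _) (dsend _ _ _) ()
    eqS-sound (send _ _) (sel _) ()
    eqS-sound (send _ _) (bra _) ()
    eqS-sound (send _ _) (spec _) ()
    eqS-sound (drecv _ _ _) end ()
    eqS-sound (drecv _ _ _) (recv _ _) ()
    eqS-sound (drecv _ _ _) (send _ _) ()
    eqS-sound (drecv _ _ _) (dsend _ _ _) ()
    eqS-sound (drecv _ _ _) (sel _) ()
    eqS-sound (drecv _ _ _) (bra _) ()
    eqS-sound (drecv _ _ _) (spec _) ()
    eqS-sound (dsend _ _ _) end ()
    eqS-sound (dsend _ _ _) (recv _ _) ()
    eqS-sound (dsend _ _ _) (send _ _) ()
    eqS-sound (dsend _ _ _) (drecv _ _ _) ()
    eqS-sound (dsend _ _ _) (sel _) ()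
    eqS-sound (dsend _ _ _) (bra _) ()
    eqS-sound (dsend _ _ _) (spec _) ()
    eqS-sound (sel _) end ()
    eqS-sound (sel _) (recv _ _) ()
    eqS-sound (sel _) (send _ _) ()
    eqS-sound (sel _) (drecv _ _ _) ()
    eqS-sound (sel _) (dsend _ _ _) ()
    eqS-sound (sel _) (bra _) ()
    eqS-sound (sel _) (spec _) ()
    eqS-sound (bra _) end ()
    eqS-sound (bra _) (recv _ _) ()
    eqS-sound (bra _) (send _ _) ()
    eqS-sound (bra _) (drecv _ _ _) ()
    eqS-sound (bra _) (dsend _ _ _) ()
    eqS-sound (bra _) (sel _) ()
    eqS-sound (bra _) (spec _) ()
    eqS-sound (spec _) end ()
    eqS-sound (spec _) (recv _ _) ()
    eqS-sound (spec _) (send _ _) ()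
    eqS-sound (spec _) (drecv _ _ _) ()
    eqS-sound (spec _) (dsend _ _ _) ()
    eqS-sound (spec _) (sel _) ()
    eqS-sound (spec _) (bra _) ()

    eqBr-sound : ∀ xs ys → T (eqBr _≟G_ _≟L_ xs ys) → xs ≡ ys
    eqBr-sound [] [] _ = refl
    eqBr-sound ((l , S) ∷ xs) ((l' , S') ∷ ys) e =
      let l≡ , e₂₃ = to (T-∧ {⌊ l ≟L l' ⌋}) e ; S≡ , xs≡ = to T-∧ e₂₃ in
      cong₂ _∷_ (cong₂ _,_ (toWitness l≡) (eqS-sound S S' S≡)) (eqBr-sound xs ys xs≡)
    eqBr-sound [] (_ ∷ _) ()
    eqBr-sound (_ ∷ _) [] ()

  mutual
    eqS-refl : ∀ S → T (eqS _≟G_ _≟L_ S S)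
    eqS-refl end             = tt
    eqS-refl (recv g S)      = from T-∧ (fromWitness refl , eqS-refl S)
    eqS-refl (send g S)      = from T-∧ (fromWitness refl , eqS-refl S)
    eqS-refl (drecv S₁ p S₂) = from T-∧ (eqS-refl S₁ , from T-∧ (eqPol-refl p , eqS-refl S₂))
    eqS-refl (dsend S₁ p S₂) = from T-∧ (eqS-refl S₁ , from T-∧ (eqPol-refl p , eqS-refl S₂))
    eqS-refl (sel xs)        = eqBr-refl xs
    eqS-refl (bra xs)        = eqBr-refl xs
    eqS-refl (spec xs)       = eqBr-refl xs

    eqBr-refl : ∀ xs → T (eqBr _≟G_ _≟L_ xs xs)
    eqBr-refl []             = tt
    eqBr-refl ((l , S) ∷ xs) = from (T-∧ {⌊ l ≟L l ⌋}) (fromWitness refl , from T-∧ (eqS-refl S , eqBr-refl xs))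

  eqS∧eqPol⇒≡ : ∀ S₁ S₁' p p' → eqS _≟G_ _≟L_ S₁ S₁' ∧ eqPol p p' ≡ true → S₁ ≡ S₁' × p ≡ p'
  eqS∧eqPol⇒≡ S₁ S₁' p p' e =
    let S₁≡ , p≡ = to T-∧ (from T-≡ e) in eqS-sound S₁ S₁' S₁≡ , eqPol-sound p p' p≡

  CorrectBranch⇒Matched : ∀ {xs ys lf} → CorrectBranch xs ys lf → Matched (λ f U U' → f ∶ U ⊣ U') xs ys lf
  CorrectBranch⇒Matched (U , U' , m , m' , d , _) = U , U' , m , m' , d

  CorrectBranch⇒Deterministic : ∀ {xs ys lf} → CorrectBranch xs ys lf → Deterministic (proj₂ lf)
  CorrectBranch⇒Deterministic (_ , _ , _ , _ , _ , δ) = δ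

  sel-bra-correct : ∀ {xs ys fs} → labels fs ≡ labels xs → All (CorrectBranch xs ys) fs →
                    Correct (sel xs) (bra ys) (Σₒ fs)
  sel-bra-correct lab bs =
    c-sel _ lab (All.map CorrectBranch⇒Matched bs) , det-Σ (All.map CorrectBranch⇒Deterministic bs)

  bra-sel-correct : ∀ {xs ys fs} → labels fs ≡ labels xs → All (CorrectBranch ys xs) fs →
                    Correct (bra ys) (sel xs) (Σₒ fs)
  bra-sel-correct lab bs =
    c-bra _ lab (All.map CorrectBranch⇒Matched bs) , det-Σ (All.map CorrectBranch⇒Deterministic bs)

  spec-bra-correct : ∀ {xs ys l U U' f} → (l , U) ∈ ys → (l , U') ∈ xs → Correct U U' f →
                     Correct (spec ys) (bra xs) (Σₒ ((l , f) ∷ []))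
  spec-bra-correct m m' (d , δ) = c-spec _ [] ([] ∷ []) ((_ , _ , m , m' , d) ∷ []) , det-Σ (δ ∷ [])

  bra-spec-correct : ∀ {xs ys l U U' f} → (l , U) ∈ xs → (l , U') ∈ ys → Correct U U' f →
                     Correct (bra xs) (spec ys) (Σₒ ((l , f) ∷ []))
  bra-spec-correct m m' (d , δ) = c-bspec _ [] ([] ∷ []) ((_ , _ , m , m' , d) ∷ []) , det-Σ (δ ∷ [])

  mutual
    synth-sound : ∀ S S' → Maybe.All (Correct S S') (Synth _≟G_ _≟L_ S S')
    synth-sound end _ = just (c-end , det-𝟙)
    synth-sound (recv g S) (send g' S') with g ≟G g'
    ... | yes refl = •?-All (Maybe.map (λ (d , δ) → c-recv d , det-• δ) (synth-sound S S'))
    ... | no _     = nothing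
    synth-sound (send g S) (recv g' S') with g ≟G g'
    ... | yes refl = •?-All (Maybe.map (λ (d , δ) → c-send d , det-• δ) (synth-sound S S'))
    ... | no _     = nothing
    synth-sound (drecv S₁ p S₂) (dsend S₁' p' S₂') with eqS _≟G_ _≟L_ S₁ S₁' ∧ eqPol p p' in e
    ... | false = nothing
    ... | true with refl , refl ← eqS∧eqPol⇒≡ S₁ S₁' p p' e =
      •?-All (Maybe.map (λ (d , δ) → c-drecv d , det-• δ) (synth-sound S₂ S₂'))
    synth-sound (dsend S₁ p S₂) (drecv S₁' p' S₂') with eqS _≟G_ _≟L_ S₁ S₁' ∧ eqPol p p' in e
    ... | false = nothing
    ... | true with refl , refl ← eqS∧eqPol⇒≡ S₁ S₁' p p' e =
      •?-All (Maybe.map (λ (d , δ) → c-dsend d , det-• δ) (synth-sound S₂ S₂'))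
    synth-sound (bra xs) (spec ys) = fstR-sound ys xs ⊆-refl
    synth-sound (spec ys) (bra xs) = fstL-sound ys xs ⊆-refl
    synth-sound (sel xs) (bra ys) =
      Σ?-All (Maybe.map (λ (lab , bs) → sel-bra-correct lab bs) (sumL-sound xs ys ⊆-refl))
    synth-sound (bra ys) (sel xs) =
      Σ?-All (Maybe.map (λ (lab , bs) → bra-sel-correct lab bs) (sumR-sound xs ys ⊆-refl))
    synth-sound (recv _ _) end = nothing
    synth-sound (recv _ _) (recv _ _) = nothing
    synth-sound (recv _ _) (drecv _ _ _) = nothing
    synth-sound (recv _ _) (dsend _ _ _) = nothing
    synth-sound (recv _ _) (sel _) = nothing
    synth-sound (recv _ _) (bra _) = nothing
    synth-sound (recv _ _) (spec _) = nothing
    synth-sound (send _ _) end = nothing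
    synth-sound (send _ _) (send _ _) = nothing
    synth-sound (send _ _) (drecv _ _ _) = nothing
    synth-sound (send _ _) (dsend _ _ _) = nothing
    synth-sound (send _ _) (sel _) = nothing
    synth-sound (send _ _) (bra _) = nothing
    synth-sound (send _ _) (spec _) = nothing
    synth-sound (drecv _ _ _) end = nothing
    synth-sound (drecv _ _ _) (recv _ _) = nothing
    synth-sound (drecv _ _ _) (send _ _) = nothing
    synth-sound (drecv _ _ _) (drecv _ _ _) = nothing
    synth-sound (drecv _ _ _) (sel _) = nothing
    synth-sound (drecv _ _ _) (bra _) = nothing
    synth-sound (drecv _ _ _) (spec _) = nothing
    synth-sound (dsend _ _ _) end = nothing
    synth-sound (dsend _ _ _) (recv _ _) = nothing
    synth-sound (dsend _ _ _) (send _ _) = nothing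
    synth-sound (dsend _ _ _) (dsend _ _ _) = nothing
    synth-sound (dsend _ _ _) (sel _) = nothing
    synth-sound (dsend _ _ _) (bra _) = nothing
    synth-sound (dsend _ _ _) (spec _) = nothing
    synth-sound (sel _) end = nothing
    synth-sound (sel _) (recv _ _) = nothing
    synth-sound (sel _) (send _ _) = nothing
    synth-sound (sel _) (drecv _ _ _) = nothing
    synth-sound (sel _) (dsend _ _ _) = nothing
    synth-sound (sel _) (sel _) = nothing
    synth-sound (sel _) (spec _) = nothing
    synth-sound (bra _) end = nothing
    synth-sound (bra _) (recv _ _) = nothing
    synth-sound (bra _) (send _ _) = nothing
    synth-sound (bra _) (drecv _ _ _) = nothing
    synth-sound (bra _) (dsend _ _ _) = nothing
    synth-sound (bra _) (bra _) = nothing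
    synth-sound (spec _) end = nothing
    synth-sound (spec _) (recv _ _) = nothing
    synth-sound (spec _) (send _ _) = nothing
    synth-sound (spec _) (drecv _ _ _) = nothing
    synth-sound (spec _) (dsend _ _ _) = nothing
    synth-sound (spec _) (sel _) = nothing
    synth-sound (spec _) (spec _) = nothing

    findL-sound : ∀ l U ys → Maybe.All (λ f → ∃ λ U' → (l , U') ∈ ys × Correct U U' f) (findL _≟G_ _≟L_ l U ys)
    findL-sound l U [] = nothing
    findL-sound l U ((l' , U') ∷ ys) with l ≟L l'
    ... | yes refl = Maybe.map (λ r → U' , here refl , r) (synth-sound U U')
    ... | no _     = Maybe.map (λ (U'' , m , r) → U'' , there m , r) (findL-sound l U ys)

    findR-sound : ∀ l U' ys → Maybe.All (λ f → ∃ λ U → (l , U) ∈ ys × Correct U U' f) (findR _≟G_ _≟L_ l U' ys)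
    findR-sound l U' [] = nothing
    findR-sound l U' ((l' , U) ∷ ys) with l ≟L l'
    ... | yes refl = Maybe.map (λ r → U , here refl , r) (synth-sound U U')
    ... | no _     = Maybe.map (λ (U'' , m , r) → U'' , there m , r) (findR-sound l U' ys)

    fstL-sound : ∀ ys xs {zs} → ys ⊆ zs → Maybe.All (Correct (spec zs) (bra xs)) (fstL _≟G_ _≟L_ ys xs)
    fstL-sound [] xs _ = nothing
    fstL-sound ((l , U) ∷ ys) xs sub =
      orElse-All (prefix-All (Maybe.map (λ (_ , m' , r) → spec-bra-correct (sub (here refl)) m' r)
                                        (findL-sound l U xs)))
                 (fstL-sound ys xs (sub ∘ there))

    fstR-sound : ∀ ys xs {zs} → ys ⊆ zs → Maybe.All (Correct (bra xs) (spec zs)) (fstR _≟G_ _≟L_ ys xs)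
    fstR-sound [] xs _ = nothing
    fstR-sound ((l , U') ∷ ys) xs sub =
      orElse-All (prefix-All (Maybe.map (λ (_ , m , r) → bra-spec-correct m (sub (here refl)) r)
                                        (findR-sound l U' xs)))
                 (fstR-sound ys xs (sub ∘ there))

    sumL-sound : ∀ xs ys {zs} → xs ⊆ zs →
                 Maybe.All (λ fs → labels fs ≡ labels xs × All (CorrectBranch zs ys) fs) (sumL _≟G_ _≟L_ xs ys)
    sumL-sound [] ys _ = just (refl , [])
    sumL-sound ((l , U) ∷ xs) ys sub =
      cons?-All (λ (U' , m' , r) (lab , bs) → cong (l ∷_) lab , (U , U' , sub (here refl) , m' , r) ∷ bs)
                (findL-sound l U ys) (sumL-sound xs ys (sub ∘ there))

    sumR-sound : ∀ xs ys {zs} → xs ⊆ zs →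
                 Maybe.All (λ fs → labels fs ≡ labels xs × All (CorrectBranch ys zs) fs) (sumR _≟G_ _≟L_ xs ys)
    sumR-sound [] ys _ = just (refl , [])
    sumR-sound ((l , U') ∷ xs) ys sub =
      cons?-All (λ (U , m , r) (lab , bs) → cong (l ∷_) lab , (U , U' , m , sub (here refl) , r) ∷ bs)
                (findR-sound l U' ys) (sumR-sound xs ys (sub ∘ there))

  findL-∈ : ∀ {l U U' ys} → Unique (labels ys) → (l , U') ∈ ys → findL _≟G_ _≟L_ l U ys ≡ Synth _≟G_ _≟L_ U U'
  findL-∈ {l} _ (here refl) rewrite ≡-≟-identity _≟L_ (refl {x = l}) = refl
  findL-∈ {l} {ys = (l' , _) ∷ _} (l∉ ∷ u) (there m) with l ≟L l'
  ... | yes refl = ⊥-elim (All.lookup l∉ (∈-map⁺ proj₁ m) refl)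
  ... | no _     = findL-∈ u m

  findR-∈ : ∀ {l U U' ys} → Unique (labels ys) → (l , U) ∈ ys → findR _≟G_ _≟L_ l U' ys ≡ Synth _≟G_ _≟L_ U U'
  findR-∈ {l} _ (here refl) rewrite ≡-≟-identity _≟L_ (refl {x = l}) = refl
  findR-∈ {l} {ys = (l' , _) ∷ _} (l∉ ∷ u) (there m) with l ≟L l'
  ... | yes refl = ⊥-elim (All.lookup l∉ (∈-map⁺ proj₁ m) refl)
  ... | no _     = findR-∈ u m

  fstL-Is-just : ∀ {l U ys xs} → (l , U) ∈ ys → Is-just (findL _≟G_ _≟L_ l U xs) → Is-just (fstL _≟G_ _≟L_ ys xs)
  fstL-Is-just (here refl) j = orElse-Is-justˡ (prefix-Is-just j)
  fstL-Is-just (there m)   j = orElse-Is-justʳ (fstL-Is-just m j)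

  fstR-Is-just : ∀ {l U' ys xs} → (l , U') ∈ ys → Is-just (findR _≟G_ _≟L_ l U' xs) → Is-just (fstR _≟G_ _≟L_ ys xs)
  fstR-Is-just (here refl) j = orElse-Is-justˡ (prefix-Is-just j)
  fstR-Is-just (there m)   j = orElse-Is-justʳ (fstR-Is-just m j)

  sumL-Is-just : ∀ {xs ys} → (∀ {l U} → (l , U) ∈ xs → Is-just (findL _≟G_ _≟L_ l U ys)) → Is-just (sumL _≟G_ _≟L_ xs ys)
  sumL-Is-just {[]}    _ = just tt
  sumL-Is-just {_ ∷ _} k = cons?-Is-just (k (here refl)) (sumL-Is-just (k ∘ there))

  sumR-Is-just : ∀ {xs ys} → (∀ {l U'} → (l , U') ∈ xs → Is-just (findR _≟G_ _≟L_ l U' ys)) → Is-just (sumR _≟G_ _≟L_ xs ys)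
  sumR-Is-just {[]}    _ = just tt
  sumR-Is-just {_ ∷ _} k = cons?-Is-just (k (here refl)) (sumR-Is-just (k ∘ there))

  sumL-complete : ∀ {xs ys fs} → Unique (labels xs) → Unique (labels ys) →
                  labels fs ≡ labels xs → All (SolvableBranch xs ys) fs → Is-just (sumL _≟G_ _≟L_ xs ys)
  sumL-complete {xs} {ys} u u' lab ss = sumL-Is-just solvable
    where
    solvable : ∀ {l U} → (l , U) ∈ xs → Is-just (findL _≟G_ _≟L_ l U ys)
    solvable m with _ , _ , U' , m₀ , m' , j ← All-at-label lab m ss
               with refl ← unique-labels⇒≡ u m m₀ = subst Is-just (sym (findL-∈ u' m')) j

  sumR-complete : ∀ {xs ys fs} → Unique (labels xs) → Unique (labels ys) →
                  labels fs ≡ labels xs → All (SolvableBranch ys xs) fs → Is-just (sumR _≟G_ _≟L_ xs ys)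
  sumR-complete {xs} {ys} u u' lab ss = sumR-Is-just solvable
    where
    solvable : ∀ {l U'} → (l , U') ∈ xs → Is-just (findR _≟G_ _≟L_ l U' ys)
    solvable m with _ , U , _ , m' , m₀ , j ← All-at-label lab m ss
               with refl ← unique-labels⇒≡ u m m₀ = subst Is-just (sym (findR-∈ u' m')) j

  mutual
    synth-complete : ∀ {f S S'} → WF S → WF S' → f ∶ S ⊣ S' → Is-just (Synth _≟G_ _≟L_ S S')
    synth-complete _ _ c-end = just tt
    synth-complete (wf-recv w) (wf-send w') (c-recv {g = g} d)
      rewrite ≡-≟-identity _≟G_ (refl {x = g}) = •?-Is-just (synth-complete w w' d)
    synth-complete (wf-send w) (wf-recv w') (c-send {g = g} d)
      rewrite ≡-≟-identity _≟G_ (refl {x = g}) = •?-Is-just (synth-complete w w' d)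
    synth-complete (wf-drecv _ w) (wf-dsend _ w') (c-drecv {S₁ = S₁} {p} d)
      rewrite to T-≡ (eqS-refl S₁) | to T-≡ (eqPol-refl p) = •?-Is-just (synth-complete w w' d)
    synth-complete (wf-dsend _ w) (wf-drecv _ w') (c-dsend {S₁ = S₁} {p} d)
      rewrite to T-≡ (eqS-refl S₁) | to T-≡ (eqPol-refl p) = •?-Is-just (synth-complete w w' d)
    synth-complete (wf-sel u a) (wf-bra u' a') (c-sel _ lab bs) =
      Σ?-Is-just (sumL-complete u u' lab (branches-complete a a' bs))
    synth-complete (wf-bra u a) (wf-sel u' a') (c-bra _ lab bs) =
      Σ?-Is-just (sumR-complete u' u lab (branches-complete a a' bs))
    synth-complete (wf-spec u a) (wf-bra u' a') (c-spec _ _ _ ((_ , _ , m , m' , d) ∷ _)) =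
      fstL-Is-just m (subst Is-just (sym (findL-∈ u' m')) (synth-complete (All.lookup a m) (All.lookup a' m') d))
    synth-complete (wf-bra u a) (wf-spec u' a') (c-bspec _ _ _ ((_ , _ , m , m' , d) ∷ _)) =
      fstR-Is-just m' (subst Is-just (sym (findR-∈ u m)) (synth-complete (All.lookup a m) (All.lookup a' m') d))

    branches-complete : ∀ {xs ys fs} → WF-branches xs → WF-branches ys →
                        All (Matched (λ f U U' → f ∶ U ⊣ U') xs ys) fs → All (SolvableBranch xs ys) fs
    branches-complete a a' [] = []
    branches-complete a a' ((U , U' , m , m' , d) ∷ bs) =
      (U , U' , m , m' , synth-complete (All.lookup a m) (All.lookup a' m') d) ∷ branches-complete a a' bs

lemma4 : ∀ {G L : Set} (_≟G_ : DecidableEquality G) (_≟L_ : DecidableEquality L)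
           (S S' : SType G L) → WF S → WF S' →
           ((Synth _≟G_ _≟L_ S S' ≢ nothing) ⇔ (S ⊣ S'))
           × (∀ (f : Orch L) → Synth _≟G_ _≟L_ S S' ≡ just f →
                (f ∶ S ⊣ S') × Deterministic f)
lemma4 _≟G_ _≟L_ S S' w w' =
  mk⇔ (λ ≢nothing → let f , d , _ = All⇒∃ sound ≢nothing in f , d)
      (λ (_ , d) → Is-just⇒≢nothing (synth-complete _≟G_ _≟L_ w w' d)) ,
  λ _ ≡just → All-≡just sound ≡just
  where
  sound = synth-sound _≟G_ _≟L_ S S'
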